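{- Let $\Gamma$ be a basis. Let $D=\{[M]\mid M\in CL\}$, for each simple type $\sigma$ let $A^\sigma=\{[M]\mid M\in CL\text{ and }\Gamma\vdash_{CL^=}M:\sigma\}$, let $[M]\cdot[N]=[MN]$, $\mathbf s=[\mathsf S]$, $\mathbf k=[\mathsf K]$, $\mathbf i=[\mathsf I]$. Then $\mathcal M^\Gamma=\langle D,\{A^\sigma\}_\sigma,\cdot,\mathbf s,\mathbf k,\mathbf i\rangle$ is an applicative structure for $LCL$.
   Context: $CL$ is the set of terms $M,N ::= x \mid \mathsf{S} \mid \mathsf{K} \mid \mathsf{I} \mid MN$ over a countable set of term variables. The equational theory $\mathcal{EQ}^\eta$ has axioms $M=M$, $\mathsf S MNL=(ML)(NL)$, $\mathsf K MN=M$, $\mathsf I M=M$ and rules: symmetry, transitivity, from $M=N$ infer $MP=NP$ and $PM=PN$, and from $Mx=Nx$ with $x$ not occurring in $M$ or $N$ infer $M=N$; $[M]$ is the equivalence class of $M$ under provable equality in $\mathcal{EQ}^\eta$. Simple types $\sigma ::= a\mid\sigma\to\tau$ (set ${\sf Types}$). A basis is a set of declarations $x:\sigma$ with pairwise distinct variables. The system $CL_\rightarrow^=$ derives $\Gamma\vdash_{CL^=}M:\sigma$ by: $x:\sigma$ if $x:\sigma\in\Gamma$; $\mathsf S:(\sigma\to(\rho\to\tau))\to((\sigma\to\rho)\to(\sigma\to\tau))$; $\mathsf K:\sigma\to(\tau\to\sigma)$; $\mathsf I:\sigma\to\sigma$ (all types); from $M:\sigma\to\tau$ and $N:\sigma$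 infer $MN:\tau$; and (eq): from $\Gamma\vdash_{CL^=}M:\sigma$ and $M=N$ provable in $\mathcal{EQ}^\eta$ infer $\Gamma\vdash_{CL^=}N:\sigma$. An applicative structure for $LCL$ is a tuple $\langle D,\{A^\sigma\}_{\sigma\in{\sf Types}},\cdot,\mathbf s,\mathbf k,\mathbf i\rangle$ where $D$ is nonempty; $A^\sigma\subseteq D$; $\cdot:D\times D\to D$ is extensional (if $d_1\cdot e=d_2\cdot e$ for all $e\in D$ then $d_1=d_2$) and maps $A^{\sigma\to\tau}\times A^\sigma$ into $A^\tau$ for all $\sigma,\tau$; $\mathbf s\in A^{(\sigma\to(\tau\to\rho))\to((\sigma\to\tau)\to(\sigma\to\rho))}$ for all $\sigma,\tau,\rho$ with $((\mathbf s\cdot d)\cdot e)\cdot f=(d\cdot f)\cdot(e\cdot f)$; $\mathbf k\in A^{\sigma\to(\tau\to\sigma)}$ for all $\sigma,\tau$ with $(\mathbf k\cdot d)\cdot e=d$; $\mathbf i\in A^{\sigma\to\sigma}$ for all $\sigma$ with $\mathbf i\cdot d=d$ (all $d,e,f\in D$). -}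

module Defs where

open import Data.Nat using (ℕ)
open import Data.Maybe using (Maybe; just)
open import Data.Product using (Σ; _×_)
open import Data.Empty using (⊥)
open import Data.Sum using (_⊎_)
open import Relation.Binary.PropositionalEquality using (_≡_)
open import Relation.Binary.Structures using (IsEquivalence)
open import Relation.Nullary using (¬_)

Var : Set
Var = ℕ

data CL : Set where
  var : Var → CL
  S K I : CL
  _∙_ : CL → CL → CL

infixl 9 _∙_

Occurs : Var → CL → Set
Occurs x (var y) = x ≡ y
Occurs x S = ⊥
Occurs x K = ⊥
Occurs x I = ⊥
Occurs x (M ∙ N) = Occurs x M ⊎ Occurs x N

infix 4 _≐_
data _≐_ : CL → CL → Set where
  eq-refl  : ∀ {M} → M ≐ M
  eq-S     : ∀ {M N L} → S ∙ M ∙ N ∙ L ≐ (M ∙ L) ∙ (N ∙ L)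
  eq-K     : ∀ {M N} → K ∙ M ∙ N ≐ M
  eq-I     : ∀ {M} → I ∙ M ≐ M
  eq-sym   : ∀ {M N} → M ≐ N → N ≐ M
  eq-trans : ∀ {M N P} → M ≐ N → N ≐ P → M ≐ P
  eq-appL  : ∀ {M N P} → M ≐ N → M ∙ P ≐ N ∙ P
  eq-appR  : ∀ {M N P} → M ≐ N → P ∙ M ≐ P ∙ N
  eq-ext   : ∀ {M N x} → ¬ Occurs x M → ¬ Occurs x N →
             M ∙ var x ≐ N ∙ var x → M ≐ N

infixr 7 _⇒_
data Type : Set where
  atom : ℕ → Type
  _⇒_  : Type → Type → Type

-- A basis: a set of declarations x:σ with pairwise distinct variables,
-- i.e. a partial function from variables to types (x:σ ∈ Γ iff Γ x ≡ just σ).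
Basis : Set
Basis = Var → Maybe Type

infix 3 _⊢_∶_
data _⊢_∶_ (Γ : Basis) : CL → Type → Set where
  ax-var : ∀ {x σ} → Γ x ≡ just σ → Γ ⊢ var x ∶ σ
  ax-S   : ∀ {σ ρ τ} → Γ ⊢ S ∶ (σ ⇒ (ρ ⇒ τ)) ⇒ ((σ ⇒ ρ) ⇒ (σ ⇒ τ))
  ax-K   : ∀ {σ τ} → Γ ⊢ K ∶ σ ⇒ (τ ⇒ σ)
  ax-I   : ∀ {σ} → Γ ⊢ I ∶ σ ⇒ σ
  app    : ∀ {M N σ τ} → Γ ⊢ M ∶ σ ⇒ τ → Γ ⊢ N ∶ σ → Γ ⊢ M ∙ N ∶ τ
  eq     : ∀ {M N σ} → Γ ⊢ M ∶ σ → M ≐ N → Γ ⊢ N ∶ σ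

-- Applicative structure for LCL, with the domain D given as a setoid
-- (carrier D modulo an equivalence _≈_ playing the role of equality on D).
record IsApplicativeStructure
    {D : Set} (_≈_ : D → D → Set)
    (A : Type → D → Set)
    (_·_ : D → D → D)
    (s k i : D) : Set₁ where
  field
    isEquivalence : IsEquivalence _≈_
    nonempty      : D
    -- A^σ is a subset of D (invariant under ≈)
    A-resp        : ∀ {σ d e} → d ≈ e → A σ d → A σ e
    -- · is a well-defined function D × D → D
    ·-cong        : ∀ {d d′ e e′} → d ≈ d′ → e ≈ e′ → (d · e) ≈ (d′ · e′)
    extensional   : ∀ {d₁ d₂} → (∀ e → (d₁ · e) ≈ (d₂ · e)) → d₁ ≈ d₂
    ·-typed       : ∀ {σ τ d e} → A (σ ⇒ τ) d → A σ e → A τ (d · e)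
    s-typed       : ∀ {σ τ ρ} → A ((σ ⇒ (τ ⇒ ρ)) ⇒ ((σ ⇒ τ) ⇒ (σ ⇒ ρ))) s
    s-eq          : ∀ d e f → (((s · d) · e) · f) ≈ ((d · f) · (e · f))
    k-typed       : ∀ {σ τ} → A (σ ⇒ (τ ⇒ σ)) k
    k-eq          : ∀ d e → ((k · d) · e) ≈ d
    i-typed       : ∀ {σ} → A (σ ⇒ σ) i
    i-eq          : ∀ d → (i · d) ≈ d

-- The term model M^Γ: D = CL/≐ ;  [M] ∈ A^σ iff [M] = [N] for some N with Γ ⊢ N : σ
TermA : Basis → Type → CL → Set
TermA Γ σ M = Σ CL (λ N → (M ≐ N) × (Γ ⊢ N ∶ σ))

module Submission where

open import Defs
open import Data.Nat using (ℕ; suc; _⊔_; _≤_)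
open import Data.Nat.Properties using (≤-trans; m≤m⊔n; m≤n⊔m; <⇒≢; <-≤-trans; n<1+n)
open import Data.Product using (_,_)
open import Data.Sum using (inj₁; inj₂)
open import Relation.Binary.PropositionalEquality using (refl)
open import Relation.Binary.Structures using (IsEquivalence)
open import Relation.Nullary using (¬_)

varBound : CL → ℕ
varBound (var y) = suc y
varBound S       = 0
varBound K       = 0
varBound I       = 0
varBound (M ∙ N) = varBound M ⊔ varBound N

varBound≤⇒¬Occurs : ∀ {x} M → varBound M ≤ x → ¬ Occurs x M
varBound≤⇒¬Occurs {x} (var y) b refl = <⇒≢ (<-≤-trans (n<1+n x) b) refl
varBound≤⇒¬Occurs (M ∙ N) b (inj₁ o) =
  varBound≤⇒¬Occurs M (≤-trans (m≤m⊔n (varBound M) (varBound N)) b) o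
varBound≤⇒¬Occurs (M ∙ N) b (inj₂ o) =
  varBound≤⇒¬Occurs N (≤-trans (m≤n⊔m (varBound M) (varBound N)) b) o

≐-isEquivalence : IsEquivalence _≐_
≐-isEquivalence = record { refl = eq-refl ; sym = eq-sym ; trans = eq-trans }

∙-cong : ∀ {M M′ N N′} → M ≐ M′ → N ≐ N′ → M ∙ N ≐ M′ ∙ N′
∙-cong p q = eq-trans (eq-appL p) (eq-appR q)

-- The rule (ext) needs only one argument: a variable fresh for both sides.
≐-extensional : ∀ {M N} → (∀ P → M ∙ P ≐ N ∙ P) → M ≐ N
≐-extensional {M} {N} h = eq-ext
  (varBound≤⇒¬Occurs M (m≤m⊔n (varBound M) (varBound N)))
  (varBound≤⇒¬Occurs N (m≤n⊔m (varBound M) (varBound N)))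
  (h (var (varBound M ⊔ varBound N)))

module _ {Γ : Basis} where

  ⊢⇒TermA : ∀ {M σ} → Γ ⊢ M ∶ σ → TermA Γ σ M
  ⊢⇒TermA t = _ , eq-refl , t

  TermA-resp-≐ : ∀ {σ M N} → M ≐ N → TermA Γ σ M → TermA Γ σ N
  TermA-resp-≐ M≐N (P , M≐P , t) = P , eq-trans (eq-sym M≐N) M≐P , t

  TermA-∙ : ∀ {σ τ M N} → TermA Γ (σ ⇒ τ) M → TermA Γ σ N → TermA Γ τ (M ∙ N)
  TermA-∙ (P , M≐P , t) (Q , N≐Q , u) = P ∙ Q , ∙-cong M≐P N≐Q , app t u

mainTheorem16 : (Γ : Basis) → IsApplicativeStructure _≐_ (TermA Γ) _∙_ S K I
mainTheorem16 Γ = record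
  { isEquivalence = ≐-isEquivalence
  ; nonempty      = S
  ; A-resp        = TermA-resp-≐
  ; ·-cong        = ∙-cong
  ; extensional   = ≐-extensional
  ; ·-typed       = TermA-∙
  ; s-typed       = ⊢⇒TermA ax-S
  ; s-eq          = λ _ _ _ → eq-S
  ; k-typed       = ⊢⇒TermA ax-K
  ; k-eq          = λ _ _ → eq-K
  ; i-typed       = ⊢⇒TermA ax-I
  ; i-eq          = λ _ → eq-I
  }
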